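{- Let $M$ be a simple matroid whose dual $M^*$ is also simple, and let $d^*$ be the size of a smallest circuit of $M$. Then $d^*$ is determined by the Möbius polynomial $\mu_M(S,T)$: that is, if $M$ and $N$ are two such matroids (simple with simple duals) with $\mu_M(S,T)=\mu_N(S,T)$, then the smallest circuit sizes of $M$ and $N$ coincide.
   Context: A matroid is simple if it has no loops and no parallel elements. For a simple matroid $M$, let $L$ be its geometric lattice of flats with rank function $r$ and Möbius function $\mu$, and $r(L)=r(M)$. The Möbius polynomial is \[ \mu_M(S,T)=\sum_{x\in L}\ \sum_{x\le y\in L}\mu(x,y)\,S^{r(x)}T^{r(L)-r(y)}. \] -}

module Defs where

open import Data.Nat as ℕ using (ℕ; zero; suc; _≤_; _<_; _⊔_)
open import Data.Integer as ℤ using (ℤ)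
open import Data.Bool as B using (Bool; true; false; if_then_else_; T)
open import Data.Fin using (Fin)
open import Data.Fin.Subset using (Subset; ⊥; ⊤; ⁅_⁆; _∈_; _∉_; _⊆_; _⊂_; ∁; _∪_; ∣_∣)
open import Data.Fin.Subset.Properties using (_⊆?_; _⊂?_)
open import Data.Vec using ([]; _∷_)
import Data.Vec
open import Data.Vec.Properties using (≡-dec)
open import Data.List as L using (List; []; _∷_; _++_; map; filter; foldr)
open import Data.Product using (Σ; ∃; _×_; _,_)
open import Relation.Nullary using (¬_; Dec; yes; no; does)
open import Relation.Binary.PropositionalEquality using (_≡_)
open import Function.Bundles using (_⇔_)

allSubsets : ∀ n → List (Subset n)
allSubsets zero    = [] ∷ []
allSubsets (suc n) = map (true ∷_) (allSubsets n) ++ map (false ∷_) (allSubsets n)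

_≟ˢ_ : ∀ {n} (x y : Subset n) → Dec (x ≡ y)
_≟ˢ_ = ≡-dec B._≟_

record Matroid (n : ℕ) : Set where
  field
    indep        : Subset n → Bool
    indep-empty  : T (indep ⊥)
    indep-down   : ∀ {X Y} → X ⊆ Y → T (indep Y) → T (indep X)
    indep-augment : ∀ {X Y} → T (indep X) → T (indep Y) → ∣ X ∣ < ∣ Y ∣ →
                    ∃ λ e → e ∈ Y × e ∉ X × T (indep (X ∪ ⁅ e ⁆))

-- Notions relative to an independence predicate (so they apply to M and M*)

module _ {n : ℕ} (ind : Subset n → Bool) where

  rankOf : Subset n → ℕ
  rankOf X = foldr (λ I r → if ind I B.∧ does (I ⊆? X) then ∣ I ∣ ⊔ r else r)
                   0 (allSubsets n)

  IsCircuit : Subset n → Set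
  IsCircuit C = ind C ≡ false × (∀ D → D ⊂ C → ind D ≡ true)

  IsSimple : Set
  IsSimple = ∀ C → IsCircuit C → ¬ (∣ C ∣ ≤ 2)

  IsMinCircuitSize : ℕ → Set
  IsMinCircuitSize d = (∃ λ C → IsCircuit C × ∣ C ∣ ≡ d) × (∀ C → IsCircuit C → d ≤ ∣ C ∣)

module _ {n : ℕ} (M : Matroid n) where
  open Matroid M

  rank : Subset n → ℕ
  rank = rankOf indep

  -- independence in the dual M*: complement contains a basis of M
  dualIndep : Subset n → Bool
  dualIndep I = does (rank (∁ I) ℕ.≟ rank ⊤)

  isFlat : Subset n → Bool
  isFlat X = foldr B._∧_ true (map (λ e → Data.Vec.lookup X e B.∨ does (rank X ℕ.<? rank (X ∪ ⁅ e ⁆)))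
                   (L.allFin n))

  flats : List (Subset n)
  flats = filter (λ X → T? (isFlat X)) (allSubsets n)
    where
    T? : (b : Bool) → Dec (T b)
    T? = B.T?

  sumℤ : List ℤ → ℤ
  sumℤ = foldr ℤ._+_ (ℤ.+ 0)

  -- Defined with fuel; fuel n+1 exceeds the length of any chain of subsets of Fin n.
  mobFuel : ℕ → Subset n → Subset n → ℤ
  mobFuel zero    x y = ℤ.+ 0
  mobFuel (suc k) x y with x ≟ˢ y
  ... | yes _ = ℤ.+ 1
  ... | no  _ with x ⊆? y
  ...   | no  _ = ℤ.+ 0
  ...   | yes _ = ℤ.- sumℤ (map (mobFuel k x)
                    (filter (λ z → x ⊆? z) (filter (λ z → z ⊂? y) flats)))

  mobius : Subset n → Subset n → ℤ
  mobius = mobFuel (suc n)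

  -- Möbius polynomial μ_M(S,T) = Σ_{x ≤ y flats} μ(x,y) S^{r(x)} T^{r(L)-r(y)},
  -- represented by its coefficient function: coefficient of S^i T^j.
  mobiusPolyCoeff : ℕ → ℕ → ℤ
  mobiusPolyCoeff i j =
    sumℤ (map (λ x → sumℤ (map (λ y →
            if does (rank x ℕ.≟ i) B.∧ does ((rank ⊤ ℕ.∸ rank y) ℕ.≟ j) B.∧ does (x ⊆? y)
            then mobius x y else ℤ.+ 0) flats)) flats)

  SimpleWithSimpleDual : Set
  SimpleWithSimpleDual = IsSimple indep × IsSimple dualIndep

  IsGirth : ℕ → Set
  IsGirth = IsMinCircuitSize indep

-- Let W_k be the number of flats of rank k and r the rank of M. In μ_M(S,T) the
-- coefficient of S^k T^(r-k) is W_k (only pairs x = y contribute, μ(x,x) = 1),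
-- and every coefficient of S-degree above r vanishes; so matroids with equal
-- polynomials have equal ranks and equal counts W_k. On the other hand, if all
-- sets of size < k+2 are independent, the rank-k flats are exactly the
-- k-subsets, so W_k = (n choose k); if moreover some circuit has size k+2, then
-- W_(k+1) < (n choose k+1), because sending a rank-(k+1) flat to its first k+1
-- elements (a basis) is injective and misses a circuit minus a point. For a
-- simple matroid W_1 = n, so M and N have ground sets of the same size, and by
-- induction on j the property "all sets of size < j are independent" holds for
-- M exactly when it holds for N. The girth is the threshold of that property.
module Submission where

open import Defs
open import Data.Nat as ℕ using (ℕ; zero; suc; _≤_; _<_; _⊔_; _∸_; _+_; z≤n; s≤s)
import Data.Nat.Properties as ℕP
open import Data.Integer as ℤ using (ℤ; +_)
import Data.Integer.Properties as ℤP
open import Data.Bool as B using (Bool; true; false; if_then_else_; T; _∧_; _∨_)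
import Data.Bool.Properties as BP
open import Data.Fin using (Fin; zero; suc)
open import Data.Fin.Subset using (Subset; ⊥; ⊤; ⁅_⁆; _∪_; ∣_∣)
  renaming (_∈_ to _∈ₛ_; _∉_ to _∉ₛ_; _⊆_ to _⊆ₛ_; _⊂_ to _⊂ₛ_)
open import Data.Fin.Subset.Properties
  using (∉⊥; ⊥⊆; ∣⊥∣≡0; ∈⊤; drop-∷-⊆; x∈p∪q⁻; x∈⁅y⁆⇒x≡y; x∈⁅x⁆; p⊆p∪q; q⊆p∪q; ∪-identityʳ;
         _∈?_; _⊆?_; _⊂?_; p⊆q⇒∣p∣≤∣q∣; p⊂q⇒∣p∣<∣q∣; ⊆-antisym)
import Data.Vec.Base as V
import Data.Vec.Properties as VP
open import Data.List as L using (List; []; _∷_; _++_; map; filter; foldr; length)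
import Data.List.Properties as LP
open import Data.List.Membership.Propositional using (_∈_; _∉_)
open import Data.List.Membership.Propositional.Properties
  using (∈-map⁺; ∈-map⁻; ∈-++⁺ˡ; ∈-++⁺ʳ; ∈-filter⁺; ∈-filter⁻; ∈-allFin)
open import Data.List.Relation.Unary.Any as Any using (here; there; any?; satisfied; _─_)
open import Data.List.Relation.Unary.All as All using ([]; _∷_)
import Data.List.Relation.Unary.All.Properties as AllP
open import Data.List.Relation.Unary.AllPairs using ([]; _∷_)
open import Data.List.Relation.Unary.Unique.Propositional using (Unique)
import Data.List.Relation.Unary.Unique.Propositional.Properties as UniqueP
open import Data.Product using (∃; _×_; _,_; proj₁; proj₂)
import Data.Sum
open import Data.Sum using (_⊎_; inj₁; inj₂)
open import Data.Empty using (⊥-elim)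
open import Function using (id; _∘_; case_of_)
open import Function.Bundles using (_⇔_; mk⇔; Equivalence)
open import Relation.Nullary using (¬_; yes; no; does)
open import Relation.Nullary.Decidable using (dec-true; dec-false; _×-dec_)
open import Relation.Unary using (Pred; Decidable)
open import Relation.Binary.PropositionalEquality
import Level

private
  variable
    A B : Set

module Counting where

  count : {P : Pred A Level.zero} → Decidable P → List A → ℕ
  count P? = length ∘ filter P?

  ∈-─ : ∀ {x z : A} (ys : List A) (x∈ : x ∈ ys) → z ∈ ys → z ≢ x → z ∈ (ys ─ x∈)
  ∈-─ (y ∷ ys) (here refl) (here refl)  z≢x = ⊥-elim (z≢x refl)
  ∈-─ (y ∷ ys) (here refl) (there z∈)   z≢x = z∈
  ∈-─ (y ∷ ys) (there x∈)  (here refl)  z≢x = here refl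
  ∈-─ (y ∷ ys) (there x∈)  (there z∈)   z≢x = there (∈-─ ys x∈ z∈ z≢x)

  unique⊆⇒length≤ : ∀ (xs ys : List A) → Unique xs → (∀ {z} → z ∈ xs → z ∈ ys) →
                    length xs ≤ length ys
  unique⊆⇒length≤ []       ys _         _   = z≤n
  unique⊆⇒length≤ (x ∷ xs) ys (x∉ ∷ u) xs⊆ =
    subst (suc (length xs) ≤_) (sym (LP.length-removeAt′ ys (Any.index x∈ys)))
      (s≤s (unique⊆⇒length≤ xs (ys ─ x∈ys) u
        (λ z∈ → ∈-─ ys x∈ys (xs⊆ (there z∈)) (λ z≡x → All.lookup x∉ z∈ (sym z≡x)))))
    where x∈ys = xs⊆ (here refl)

  module _ (f : A → B) where

    InjectiveOn : List A → Set
    InjectiveOn xs = ∀ {a b} → a ∈ xs → b ∈ xs → f a ≡ f b → a ≡ b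

    unique-map : ∀ xs → Unique xs → InjectiveOn xs → Unique (map f xs)
    unique-map []       _        _   = []
    unique-map (x ∷ xs) (x∉ ∷ u) inj =
      All.tabulate fx≢ ∷ unique-map xs u (λ a∈ b∈ → inj (there a∈) (there b∈))
      where
      fx≢ : ∀ {w} → w ∈ map f xs → f x ≢ w
      fx≢ w∈ fx≡w with ∈-map⁻ f w∈
      ... | b , b∈ , refl = All.lookup x∉ b∈ (inj (here refl) (there b∈) fx≡w)

    injection-missing⇒length< : ∀ xs ys {y : B} → Unique xs → InjectiveOn xs →
      (∀ {a} → a ∈ xs → f a ∈ ys) → y ∈ ys → y ∉ map f xs → length xs < length ys
    injection-missing⇒length< xs ys {y} u inj into y∈ y∉ =
      subst (λ t → suc t ≤ length ys) (LP.length-map f xs)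
        (unique⊆⇒length≤ (y ∷ map f xs) ys
          (All.tabulate (λ w∈ y≡w → y∉ (subst (_∈ map f xs) (sym y≡w) w∈)) ∷ unique-map xs u inj)
          λ { (here refl) → y∈ ; (there w∈) → image w∈ })
      where
      image : ∀ {w} → w ∈ map f xs → w ∈ ys
      image w∈ with ∈-map⁻ f w∈
      ... | a , a∈ , refl = into a∈

  count-none : {P : Pred A Level.zero} (P? : Decidable P) (xs : List A) →
               (∀ {x} → x ∈ xs → ¬ P x) → count P? xs ≡ 0
  count-none P? xs none = cong length (LP.filter-none P? (All.tabulate none))

  count-++ : {P : Pred A Level.zero} (P? : Decidable P) (xs ys : List A) →
             count P? (xs ++ ys) ≡ count P? xs + count P? ys
  count-++ P? xs ys = trans (cong length (LP.filter-++ P? xs ys)) (LP.length-++ (filter P? xs))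

  count-filter : {P Q R : Pred A Level.zero} (P? : Decidable P) (Q? : Decidable Q) (R? : Decidable R)
    (xs : List A) → (∀ {x} → x ∈ xs → R x ⇔ (Q x × P x)) → count P? (filter Q? xs) ≡ count R? xs
  count-filter P? Q? R? []       _ = refl
  count-filter P? Q? R? (x ∷ xs) R⇔QP
    with Q? x | R? x | count-filter P? Q? R? xs (R⇔QP ∘ there)
  ... | no ¬q | no _  | ih = ih
  ... | no ¬q | yes r | _  = ⊥-elim (¬q (proj₁ (Equivalence.to (R⇔QP (here refl)) r)))
  ... | yes q | no ¬r | ih with P? x
  ...   | no _  = ih
  ...   | yes p = ⊥-elim (¬r (Equivalence.from (R⇔QP (here refl)) (q , p)))
  count-filter P? Q? R? (x ∷ xs) R⇔QP | yes q | yes r | ih with P? x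
  ...   | yes _ = cong suc ih
  ...   | no ¬p = ⊥-elim (¬p (proj₂ (Equivalence.to (R⇔QP (here refl)) r)))


  count-map : {P : Pred B Level.zero} {Q : Pred A Level.zero} (P? : Decidable P) (Q? : Decidable Q)
    (f : A → B) (xs : List A) → (∀ x → does (P? (f x)) ≡ does (Q? x)) → count P? (map f xs) ≡ count Q? xs
  count-map P? Q? f []       _ = refl
  count-map P? Q? f (x ∷ xs) agree with does (P? (f x)) | does (Q? x) | agree x
  ... | true  | true  | _ = cong suc (count-map P? Q? f xs agree)
  ... | false | false | _ = count-map P? Q? f xs agree

module Sums where
  open Counting using (count)

  sumList : List ℤ → ℤ
  sumList = foldr ℤ._+_ (+ 0)

  sum-cong : (f g : A → ℤ) (xs : List A) → (∀ {x} → x ∈ xs → f x ≡ g x) →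
             sumList (map f xs) ≡ sumList (map g xs)
  sum-cong f g []       _   = refl
  sum-cong f g (x ∷ xs) f≡g = cong₂ ℤ._+_ (f≡g (here refl)) (sum-cong f g xs (f≡g ∘ there))

  sum-zero : (f : A → ℤ) (xs : List A) → (∀ {x} → x ∈ xs → f x ≡ + 0) → sumList (map f xs) ≡ + 0
  sum-zero f []       _   = refl
  sum-zero f (x ∷ xs) f≡0 rewrite f≡0 (here refl) | sum-zero f xs (f≡0 ∘ there) = refl

  sum-single : (f : A → ℤ) (xs : List A) {x : A} → Unique xs → x ∈ xs →
    (∀ {y} → y ∈ xs → y ≢ x → f y ≡ + 0) → f x ≡ + 1 → sumList (map f xs) ≡ + 1
  sum-single f (y ∷ xs) (y∉ ∷ _) (here refl) others fx≡1
    rewrite fx≡1 | sum-zero f xs (λ z∈ → others (there z∈) (λ z≡y → All.lookup y∉ z∈ (sym z≡y))) = refl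
  sum-single f (y ∷ xs) (y∉ ∷ u) (there x∈) others fx≡1
    rewrite others (here refl) (All.lookup y∉ x∈) | sum-single f xs u x∈ (others ∘ there) fx≡1 = refl

  sum-indicator : {P : Pred A Level.zero} (P? : Decidable P) (xs : List A) →
    sumList (map (λ x → if does (P? x) then + 1 else + 0) xs) ≡ + count P? xs
  sum-indicator P? []       = refl
  sum-indicator P? (x ∷ xs) with does (P? x)
  ... | true  rewrite sum-indicator P? xs = refl
  ... | false rewrite sum-indicator P? xs = refl

module Subsets where
  open Counting

  allSubsets-complete : ∀ n (X : Subset n) → X ∈ allSubsets n
  allSubsets-complete zero    V.[]          = here refl
  allSubsets-complete (suc n) (true V.∷ X)  = ∈-++⁺ˡ (∈-map⁺ (true V.∷_) (allSubsets-complete n X))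
  allSubsets-complete (suc n) (false V.∷ X) =
    ∈-++⁺ʳ (map (true V.∷_) (allSubsets n)) (∈-map⁺ (false V.∷_) (allSubsets-complete n X))

  allSubsets-unique : ∀ n → Unique (allSubsets n)
  allSubsets-unique zero    = [] ∷ []
  allSubsets-unique (suc n) =
    UniqueP.++⁺ (UniqueP.map⁺ ∷-injective (allSubsets-unique n))
                (UniqueP.map⁺ ∷-injective (allSubsets-unique n)) disjoint
    where
    ∷-injective : ∀ {b} {X Y : Subset n} → b V.∷ X ≡ b V.∷ Y → X ≡ Y
    ∷-injective refl = refl
    disjoint : ∀ {Z} → ¬ (Z ∈ map (true V.∷_) (allSubsets n) × Z ∈ map (false V.∷_) (allSubsets n))
    disjoint (p , q) with ∈-map⁻ (true V.∷_) p | ∈-map⁻ (false V.∷_) q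
    ... | _ , _ , refl | _ , _ , ()

  choose : ℕ → ℕ → ℕ
  choose n k = count (λ X → ∣ X ∣ ℕ.≟ k) (allSubsets n)

  -- Pascal's rule, split by whether the first element belongs to the subset:
  -- the subsets containing it are counted by any predicate Q agreeing with
  -- "suc ∣ X ∣ = k" on the remaining n elements.
  choose-split : ∀ n k {Q : Pred (Subset n) Level.zero} (Q? : Decidable Q) →
    (∀ X → does (suc ∣ X ∣ ℕ.≟ k) ≡ does (Q? X)) → choose (suc n) k ≡ count Q? (allSubsets n) + choose n k
  choose-split n k Q? agree =
    trans (count-++ size≟k (map (true V.∷_) (allSubsets n)) _)
          (cong₂ _+_ (count-map size≟k Q? (true V.∷_) (allSubsets n) agree)
                     (count-map size≟k (λ X → ∣ X ∣ ℕ.≟ k) (false V.∷_) (allSubsets n) (λ _ → refl)))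
    where
    size≟k : Decidable (λ (X : Subset (suc n)) → ∣ X ∣ ≡ k)
    size≟k X = ∣ X ∣ ℕ.≟ k

  choose-zero : ∀ n → choose n 0 ≡ 1
  choose-zero zero    = refl
  choose-zero (suc n) = trans (choose-split n 0 (λ X → suc ∣ X ∣ ℕ.≟ 0) (λ _ → refl))
    (cong₂ _+_ (count-none _ (allSubsets n) (λ _ ())) (choose-zero n))

  choose-one : ∀ n → choose n 1 ≡ n
  choose-one zero    = refl
  choose-one (suc n) = trans (choose-split n 1 (λ X → ∣ X ∣ ℕ.≟ 0) (λ _ → refl))
    (cong₂ _+_ (choose-zero n) (choose-one n))

  ∣∪⁅⁆∣ : ∀ {n} (X : Subset n) (e : Fin n) → e ∉ₛ X → ∣ X ∪ ⁅ e ⁆ ∣ ≡ suc ∣ X ∣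
  ∣∪⁅⁆∣ (true V.∷ X)  zero    e∉ = ⊥-elim (e∉ V.here)
  ∣∪⁅⁆∣ (false V.∷ X) zero    _  = cong (λ Y → suc ∣ Y ∣) (∪-identityʳ X)
  ∣∪⁅⁆∣ (true V.∷ X)  (suc e) e∉ = cong suc (∣∪⁅⁆∣ X e (e∉ ∘ V.there))
  ∣∪⁅⁆∣ (false V.∷ X) (suc e) e∉ = ∣∪⁅⁆∣ X e (e∉ ∘ V.there)

  ∪⁅⁆-⊆ : ∀ {n} {X F : Subset n} {e} → X ⊆ₛ F → e ∈ₛ F → X ∪ ⁅ e ⁆ ⊆ₛ F
  ∪⁅⁆-⊆ {X = X} {e = e} X⊆F e∈F z∈ with x∈p∪q⁻ X ⁅ e ⁆ z∈
  ... | inj₁ z∈X = X⊆F z∈X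
  ... | inj₂ z∈e rewrite x∈⁅y⁆⇒x≡y e z∈e = e∈F

  prefix : ∀ {n} → ℕ → Subset n → Subset n
  prefix zero    X               = ⊥
  prefix (suc k) V.[]            = V.[]
  prefix (suc k) (true V.∷ X)  = true V.∷ prefix k X
  prefix (suc k) (false V.∷ X) = false V.∷ prefix (suc k) X

  prefix-⊆ : ∀ {n} k (X : Subset n) → prefix k X ⊆ₛ X
  prefix-⊆ zero    X               x∈           = ⊥-elim (∉⊥ x∈)
  prefix-⊆ (suc k) (true V.∷ X)  V.here       = V.here
  prefix-⊆ (suc k) (true V.∷ X)  (V.there x∈) = V.there (prefix-⊆ k X x∈)
  prefix-⊆ (suc k) (false V.∷ X) (V.there x∈) = V.there (prefix-⊆ (suc k) X x∈)

  ∣prefix∣ : ∀ {n} k (X : Subset n) → k ≤ ∣ X ∣ → ∣ prefix k X ∣ ≡ k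
  ∣prefix∣ {n} zero X _                 = ∣⊥∣≡0 n
  ∣prefix∣ (suc k) (true V.∷ X) (s≤s k≤) = cong suc (∣prefix∣ k X k≤)
  ∣prefix∣ (suc k) (false V.∷ X) k≤      = ∣prefix∣ (suc k) X k≤

  dropMin : ∀ {n} → Subset n → Subset n
  dropMin V.[]            = V.[]
  dropMin (true V.∷ X)  = false V.∷ X
  dropMin (false V.∷ X) = false V.∷ dropMin X

  ∣dropMin∣ : ∀ {n} k (X : Subset n) → ∣ X ∣ ≡ suc k → ∣ dropMin X ∣ ≡ k
  ∣dropMin∣ k (true V.∷ X)  ∣X∣≡ = ℕP.suc-injective ∣X∣≡
  ∣dropMin∣ k (false V.∷ X) ∣X∣≡ = ∣dropMin∣ k X ∣X∣≡

  dropMin-removes-one : ∀ {n} (X : Subset n) {x y} →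
    x ∈ₛ X → x ∉ₛ dropMin X → y ∈ₛ X → y ∉ₛ dropMin X → x ≡ y
  dropMin-removes-one (true V.∷ X)  V.here       _  V.here       _  = refl
  dropMin-removes-one (true V.∷ X)  V.here       _  (V.there y∈) y∉ = ⊥-elim (y∉ (V.there y∈))
  dropMin-removes-one (true V.∷ X)  (V.there x∈) x∉ _            _  = ⊥-elim (x∉ (V.there x∈))
  dropMin-removes-one (false V.∷ X) (V.there x∈) x∉ (V.there y∈) y∉ =
    cong suc (dropMin-removes-one X x∈ (x∉ ∘ V.there) y∈ (y∉ ∘ V.there))

  dropMin-restore : ∀ {n} (X : Subset n) {e} → e ∈ₛ X → e ∉ₛ dropMin X → X ⊆ₛ dropMin X ∪ ⁅ e ⁆
  dropMin-restore X {e} e∈ e∉ {z} z∈ with z ∈? dropMin X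
  ... | yes z∈′ = p⊆p∪q ⁅ e ⁆ z∈′
  ... | no  z∉  rewrite dropMin-removes-one X z∈ z∉ e∈ e∉ = q⊆p∪q (dropMin X) ⁅ e ⁆ (x∈⁅x⁆ e)

  -- If C ⊆ F then the least element of F is at most that of C, so the first
  -- k+1 elements of F contain an element that dropMin C misses.
  prefix≢dropMin : ∀ {n} k (C F : Subset n) → C ⊆ₛ F → ∣ C ∣ ≡ suc (suc k) → prefix (suc k) F ≢ dropMin C
  prefix≢dropMin k (true V.∷ C)  (true V.∷ F)  _   _    ()
  prefix≢dropMin k (true V.∷ C)  (false V.∷ F) C⊆F _    _ with C⊆F V.here
  ... | ()
  prefix≢dropMin k (false V.∷ C) (true V.∷ F)  _   _    ()
  prefix≢dropMin k (false V.∷ C) (false V.∷ F) C⊆F ∣C∣≡ eq =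
    prefix≢dropMin k C F (drop-∷-⊆ C⊆F) ∣C∣≡ (cong V.tail eq)

module MatroidTheory {n : ℕ} (M : Matroid n) where
  open Matroid M
  open Subsets

  T⇒≡ : ∀ {b} → T b → b ≡ true
  T⇒≡ = Equivalence.to BP.T-≡

  ≡⇒T : ∀ {b} → b ≡ true → T b
  ≡⇒T = Equivalence.from BP.T-≡

  private
    rankStep : Subset n → Subset n → ℕ → ℕ
    rankStep X I r = if indep I ∧ does (I ⊆? X) then ∣ I ∣ ⊔ r else r

    rank-bound′ : ∀ X I Is → I ∈ Is → indep I ≡ true → I ⊆ₛ X → ∣ I ∣ ≤ foldr (rankStep X) 0 Is
    rank-bound′ X I (J ∷ Is) (here refl) indI I⊆X
      rewrite indI | dec-true (I ⊆? X) I⊆X = ℕP.m≤m⊔n _ _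
    rank-bound′ X I (J ∷ Is) (there I∈) indI I⊆X with indep J ∧ does (J ⊆? X)
    ... | true  = ℕP.≤-trans (rank-bound′ X I Is I∈ indI I⊆X) (ℕP.m≤n⊔m _ _)
    ... | false = rank-bound′ X I Is I∈ indI I⊆X

    rank-attained′ : ∀ X Is → ∃ λ I → indep I ≡ true × I ⊆ₛ X × ∣ I ∣ ≡ foldr (rankStep X) 0 Is
    rank-attained′ X []       = ⊥ , T⇒≡ indep-empty , ⊥⊆ , ∣⊥∣≡0 n
    rank-attained′ X (J ∷ Is) with indep J in indJ | J ⊆? X
    ... | false | _        = rank-attained′ X Is
    ... | true  | no _     = rank-attained′ X Is
    ... | true  | yes J⊆X with ℕP.⊔-sel ∣ J ∣ (foldr (rankStep X) 0 Is)
    ...   | inj₁ J-wins = J , indJ , J⊆X , sym J-wins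
    ...   | inj₂ Is-win with rank-attained′ X Is
    ...     | I , indI , I⊆X , ∣I∣≡ = I , indI , I⊆X , trans ∣I∣≡ (sym Is-win)

  rank-bound : ∀ X I → indep I ≡ true → I ⊆ₛ X → ∣ I ∣ ≤ rank M X
  rank-bound X I = rank-bound′ X I (allSubsets n) (allSubsets-complete n I)

  rank-attained : ∀ X → ∃ λ I → indep I ≡ true × I ⊆ₛ X × ∣ I ∣ ≡ rank M X
  rank-attained X = rank-attained′ X (allSubsets n)

  rank-mono : ∀ {X Y} → X ⊆ₛ Y → rank M X ≤ rank M Y
  rank-mono {X} {Y} X⊆Y with rank-attained X
  ... | I , indI , I⊆X , ∣I∣≡ = subst (_≤ rank M Y) ∣I∣≡ (rank-bound Y I indI (X⊆Y ∘ I⊆X))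

  rank≤size : ∀ X → rank M X ≤ ∣ X ∣
  rank≤size X with rank-attained X
  ... | I , _ , I⊆X , ∣I∣≡ = subst (_≤ ∣ X ∣) ∣I∣≡ (p⊆q⇒∣p∣≤∣q∣ I⊆X)

  rank-indep : ∀ X → indep X ≡ true → rank M X ≡ ∣ X ∣
  rank-indep X indX = ℕP.≤-antisym (rank≤size X) (rank-bound X X indX id)

  rank≤rank⊤ : ∀ X → rank M X ≤ rank M ⊤
  rank≤rank⊤ X = rank-mono (λ _ → ∈⊤)

  dependent-above-rank : ∀ F Y → Y ⊆ₛ F → rank M F < ∣ Y ∣ → indep Y ≡ false
  dependent-above-rank F Y Y⊆F r<∣Y∣ with indep Y in indY
  ... | false = refl
  ... | true  = ⊥-elim (ℕP.<⇒≱ r<∣Y∣ (rank-bound F Y indY Y⊆F))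

  Flat : Subset n → Set
  Flat X = T (isFlat M X)

  flat⇒rank-jump : ∀ {F} e → Flat F → e ∉ₛ F → rank M F < rank M (F ∪ ⁅ e ⁆)
  flat⇒rank-jump {F} e flatF e∉
    with V.lookup F e in F[e] | All.lookup (AllP.all⁺ _ (L.allFin n) flatF) (∈-allFin e)
  ... | true  | _    = ⊥-elim (e∉ (VP.lookup⇒[]= e F F[e]))
  ... | false | jump = ℕP.<ᵇ⇒< (rank M F) (rank M (F ∪ ⁅ e ⁆)) jump

  rank-jump⇒flat : ∀ F → (∀ e → e ∉ₛ F → rank M F < rank M (F ∪ ⁅ e ⁆)) → Flat F
  rank-jump⇒flat F jump = AllP.all⁻ _ {xs = L.allFin n} (All.tabulate (λ {e} _ → jumpAt e))
    where
    jumpAt : ∀ e → T (V.lookup F e ∨ does (rank M F ℕP.<? rank M (F ∪ ⁅ e ⁆)))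
    jumpAt e with V.lookup F e in F[e]
    ... | true  = _
    ... | false = ℕP.<⇒<ᵇ (jump e (λ e∈ → case trans (sym (VP.[]=⇒lookup e∈)) F[e] of λ ()))

  ⊤-flat : Flat ⊤
  ⊤-flat = rank-jump⇒flat ⊤ (λ e e∉ → ⊥-elim (e∉ ∈⊤))

  flat-⊆-same-rank : ∀ {F Y} → Flat F → F ⊆ₛ Y → rank M F ≡ rank M Y → F ≡ Y
  flat-⊆-same-rank {F} {Y} flatF F⊆Y rF≡rY = ⊆-antisym F⊆Y Y⊆F
    where
    Y⊆F : Y ⊆ₛ F
    Y⊆F {e} e∈Y with e ∈? F
    ... | yes e∈F = e∈F
    ... | no  e∉F = ⊥-elim (ℕP.<⇒≱ (flat⇒rank-jump e flatF e∉F)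
                      (subst (rank M (F ∪ ⁅ e ⁆) ≤_) (sym rF≡rY) (rank-mono (∪⁅⁆-⊆ F⊆Y e∈Y))))

  -- An independent X ⊆ F with ∣X∣ = r(F) spans F: anything that makes X
  -- dependent already lies in F (otherwise augmentation from a basis of F ∪ {e}
  -- would produce an independent subset of F larger than its rank).
  spanned-by-basis : ∀ {F X} e → Flat F → X ⊆ₛ F → indep X ≡ true → ∣ X ∣ ≡ rank M F →
                     indep (X ∪ ⁅ e ⁆) ≡ false → e ∈ₛ F
  spanned-by-basis {F} {X} e flatF X⊆F indX ∣X∣≡rF dep with e ∈? F
  ... | yes e∈F = e∈F
  ... | no  e∉F with rank-attained (F ∪ ⁅ e ⁆)
  ... | I , indI , I⊆Fe , ∣I∣≡ with indep-augment (≡⇒T indX) (≡⇒T indI)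
          (subst₂ _<_ (sym ∣X∣≡rF) (sym ∣I∣≡) (flat⇒rank-jump e flatF e∉F))
  ... | f , f∈I , f∉X , indXf with x∈p∪q⁻ F ⁅ e ⁆ (I⊆Fe f∈I)
  ...   | inj₂ f∈e rewrite x∈⁅y⁆⇒x≡y e f∈e = ⊥-elim (subst T dep indXf)
  ...   | inj₁ f∈F = ⊥-elim (ℕP.n≮n (rank M F) (subst (λ k → suc k ≤ rank M F) ∣X∣≡rF
            (subst (_≤ rank M F) (∣∪⁅⁆∣ X f f∉X) (rank-bound F (X ∪ ⁅ f ⁆) (T⇒≡ indXf) (∪⁅⁆-⊆ X⊆F f∈F)))))

  -- A common basis X of F and of a flat G forces F ⊆ G: every e ∈ F ∖ X makes X
  -- dependent, so e lies in the span G of X.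
  basis-⊆-flat : ∀ {F G X} → Flat G → X ⊆ₛ F → X ⊆ₛ G → indep X ≡ true →
                 ∣ X ∣ ≡ rank M F → ∣ X ∣ ≡ rank M G → F ⊆ₛ G
  basis-⊆-flat {F} {G} {X} flatG X⊆F X⊆G indX ∣X∣≡rF ∣X∣≡rG {e} e∈F with e ∈? X
  ... | yes e∈X = X⊆G e∈X
  ... | no  e∉X = spanned-by-basis e flatG X⊆G indX ∣X∣≡rG
        (dependent-above-rank F (X ∪ ⁅ e ⁆) (∪⁅⁆-⊆ X⊆F e∈F)
          (subst₂ _<_ ∣X∣≡rF (sym (∣∪⁅⁆∣ X e e∉X)) (ℕP.n<1+n ∣ X ∣)))

  flats-sharing-basis : ∀ {F G X} → Flat F → Flat G → X ⊆ₛ F → X ⊆ₛ G → indep X ≡ true →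
                        ∣ X ∣ ≡ rank M F → ∣ X ∣ ≡ rank M G → F ≡ G
  flats-sharing-basis flatF flatG X⊆F X⊆G indX ∣X∣≡rF ∣X∣≡rG =
    ⊆-antisym (basis-⊆-flat flatG X⊆F X⊆G indX ∣X∣≡rF ∣X∣≡rG)
              (basis-⊆-flat flatF X⊆G X⊆F indX ∣X∣≡rG ∣X∣≡rF)

  circuit-⊆-flat : ∀ {F C} → Flat F → IsCircuit indep C → dropMin C ⊆ₛ F →
                   indep (dropMin C) ≡ true → ∣ dropMin C ∣ ≡ rank M F → C ⊆ₛ F
  circuit-⊆-flat {F} {C} flatF (depC , _) D⊆F indD ∣D∣≡rF {e} e∈C with e ∈? dropMin C
  ... | yes e∈D = D⊆F e∈D
  ... | no  e∉D = spanned-by-basis e flatF D⊆F indD ∣D∣≡rF depDe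
    where
    depDe : indep (dropMin C ∪ ⁅ e ⁆) ≡ false
    depDe with indep (dropMin C ∪ ⁅ e ⁆) in indDe
    ... | false = refl
    ... | true  = ⊥-elim (subst T depC (indep-down (dropMin-restore C e∈C e∉D) (≡⇒T indDe)))

  dependent⇒circuit : ∀ X → indep X ≡ false → ∃ λ C → C ⊆ₛ X × IsCircuit indep C
  dependent⇒circuit X = descend ∣ X ∣ X ℕP.≤-refl
    where
    descend : ∀ bound X → ∣ X ∣ ≤ bound → indep X ≡ false → ∃ λ C → C ⊆ₛ X × IsCircuit indep C
    descend bound X ∣X∣≤ depX
      with any? (λ D → (D ⊂? X) ×-dec (indep D B.≟ false)) (allSubsets n)
    ... | no no-dependent-subset = X , id , depX , minimal
      where
      minimal : ∀ D → D ⊂ₛ X → indep D ≡ true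
      minimal D D⊂X with indep D in indD
      ... | true  = refl
      ... | false = ⊥-elim (no-dependent-subset
                      (Any.map (λ { refl → D⊂X , indD }) (allSubsets-complete n D)))
    ... | yes some with satisfied some
    ...   | D , D⊂X , depD with bound
    ...     | zero    = ⊥-elim (ℕP.n≮0 (ℕP.<-≤-trans (p⊂q⇒∣p∣<∣q∣ D⊂X) ∣X∣≤))
    ...     | suc b with descend b D (ℕP.≤-pred (ℕP.<-≤-trans (p⊂q⇒∣p∣<∣q∣ D⊂X) ∣X∣≤)) depD
    ...       | C , C⊆D , circC = C , proj₁ D⊂X ∘ C⊆D , circC

  IndepBelow : ℕ → Set
  IndepBelow j = ∀ X → ∣ X ∣ < j → indep X ≡ true

  IndepBelow? : ∀ j → IndepBelow j ⊎ (∃ λ X → ∣ X ∣ < j × indep X ≡ false)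
  IndepBelow? j with any? (λ X → (∣ X ∣ ℕP.<? j) ×-dec (indep X B.≟ false)) (allSubsets n)
  ... | yes some = inj₂ (satisfied some)
  ... | no  none = inj₁ indepBelow
    where
    indepBelow : IndepBelow j
    indepBelow X ∣X∣<j with indep X in indX
    ... | true  = refl
    ... | false = ⊥-elim (none (Any.map (λ { refl → ∣X∣<j , indX }) (allSubsets-complete n X)))

  IndepBelow-mono : ∀ {i j} → i ≤ j → IndepBelow j → IndepBelow i
  IndepBelow-mono i≤j below X ∣X∣<i = below X (ℕP.<-≤-trans ∣X∣<i i≤j)

  circuit-size≥ : ∀ {j C} → IndepBelow j → IsCircuit indep C → j ≤ ∣ C ∣
  circuit-size≥ {C = C} below (depC , _) =
    ℕP.≮⇒≥ (λ ∣C∣<j → case trans (sym depC) (below C ∣C∣<j) of λ ())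

  circuits≥⇒IndepBelow : ∀ j → (∀ C → IsCircuit indep C → j ≤ ∣ C ∣) → IndepBelow j
  circuits≥⇒IndepBelow j big X ∣X∣<j with indep X in indX
  ... | true  = refl
  ... | false with dependent⇒circuit X indX
  ... | C , C⊆X , circC = ⊥-elim (ℕP.<⇒≱ ∣X∣<j (ℕP.≤-trans (big C circC) (p⊆q⇒∣p∣≤∣q∣ C⊆X)))

  simple⇒IndepBelow3 : IsSimple indep → IndepBelow 3
  simple⇒IndepBelow3 simple =
    circuits≥⇒IndepBelow 3 (λ C circC → ℕP.≰⇒> (simple C circC))

  girth⇔threshold : ∀ d → IsGirth M d ⇔ (IndepBelow d × ¬ IndepBelow (suc d))
  girth⇔threshold d = mk⇔ to from
    where
    to : IsGirth M d → IndepBelow d × ¬ IndepBelow (suc d)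
    to ((C , circC , ∣C∣≡d) , minimal) =
      circuits≥⇒IndepBelow d minimal ,
      λ below → ℕP.<⇒≱ (ℕP.n<1+n d) (subst (suc d ≤_) ∣C∣≡d (circuit-size≥ below circC))
    from : IndepBelow d × ¬ IndepBelow (suc d) → IsGirth M d
    from (below , not-below) with IndepBelow? (suc d)
    ... | inj₁ below′ = ⊥-elim (not-below below′)
    ... | inj₂ (X , ∣X∣≤d , depX) with dependent⇒circuit X depX
    ... | C , C⊆X , circC =
      (C , circC , ℕP.≤-antisym (ℕP.≤-trans (p⊆q⇒∣p∣≤∣q∣ C⊆X) (ℕP.≤-pred ∣X∣≤d)) (circuit-size≥ below circC)) ,
      λ C′ circC′ → circuit-size≥ below circC′

module FlatCounts {n : ℕ} (M : Matroid n) where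
  open Matroid M
  open Counting
  open Subsets
  open MatroidTheory M

  Flat? : Decidable Flat
  Flat? X = B.T? (isFlat M X)

  flats-complete : ∀ {X} → Flat X → X ∈ flats M
  flats-complete {X} = ∈-filter⁺ Flat? (allSubsets-complete n X)

  flats-sound : ∀ {X} → X ∈ flats M → Flat X
  flats-sound X∈ = proj₂ (∈-filter⁻ Flat? {xs = allSubsets n} X∈)

  flats-unique : Unique (flats M)
  flats-unique = UniqueP.filter⁺ Flat? (allSubsets-unique n)

  flatCount : ℕ → ℕ
  flatCount k = count (λ X → rank M X ℕ.≟ k) (flats M)

  flatCount-rank⊤ : 1 ≤ flatCount (rank M ⊤)
  flatCount-rank⊤ = LP.filter-some (λ X → rank M X ℕ.≟ rank M ⊤)
                      (Any.map (λ { refl → refl }) (flats-complete ⊤-flat))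

  flatCount-above-rank : ∀ k → rank M ⊤ < k → flatCount k ≡ 0
  flatCount-above-rank k r<k = count-none (λ X → rank M X ℕ.≟ k) (flats M)
    (λ {X} _ rX≡k → ℕP.<⇒≱ r<k (subst (_≤ rank M ⊤) rX≡k (rank≤rank⊤ X)))

  flat-of-rank⇔size : ∀ k → IndepBelow (suc (suc k)) → ∀ X → ∣ X ∣ ≡ k ⇔ (Flat X × rank M X ≡ k)
  flat-of-rank⇔size k below X = mk⇔ to from
    where
    small-indep : ∀ Y → ∣ Y ∣ ≤ suc k → indep Y ≡ true
    small-indep Y ∣Y∣≤ = below Y (s≤s ∣Y∣≤)

    to : ∣ X ∣ ≡ k → Flat X × rank M X ≡ k
    to ∣X∣≡k = rank-jump⇒flat X jump , trans (rank-indep X indX) ∣X∣≡k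
      where
      indX : indep X ≡ true
      indX = small-indep X (ℕP.m≤n⇒m≤1+n (ℕP.≤-reflexive ∣X∣≡k))
      jump : ∀ e → e ∉ₛ X → rank M X < rank M (X ∪ ⁅ e ⁆)
      jump e e∉ = begin-strict
        rank M X              ≡⟨ rank-indep X indX ⟩
        ∣ X ∣                 <⟨ ℕP.n<1+n ∣ X ∣ ⟩
        suc ∣ X ∣             ≡⟨ ∣∪⁅⁆∣ X e e∉ ⟨
        ∣ X ∪ ⁅ e ⁆ ∣         ≡⟨ rank-indep (X ∪ ⁅ e ⁆) indXe ⟨
        rank M (X ∪ ⁅ e ⁆)    ∎
        where
        open ℕP.≤-Reasoning
        indXe = small-indep (X ∪ ⁅ e ⁆) (ℕP.≤-reflexive (trans (∣∪⁅⁆∣ X e e∉) (cong suc ∣X∣≡k)))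

    -- a flat of rank k with more than k elements would contain an independent
    -- (k+1)-subset, its first k+1 elements
    from : Flat X × rank M X ≡ k → ∣ X ∣ ≡ k
    from (_ , rX≡k) with suc k ℕP.≤? ∣ X ∣
    ... | no  ∣X∣≯k = ℕP.≤-antisym (ℕP.≤-pred (ℕP.≰⇒> ∣X∣≯k)) (subst (_≤ ∣ X ∣) rX≡k (rank≤size X))
    ... | yes k<∣X∣ = case trans (sym (small-indep P (ℕP.≤-reflexive ∣P∣≡))) depP of λ ()
      where
      P = prefix (suc k) X
      ∣P∣≡ = ∣prefix∣ (suc k) X k<∣X∣
      depP = dependent-above-rank X P (prefix-⊆ (suc k) X)
               (subst₂ _<_ (sym rX≡k) (sym ∣P∣≡) (ℕP.n<1+n k))

  flatCount≡choose : ∀ k → IndepBelow (suc (suc k)) → flatCount k ≡ choose n k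
  flatCount≡choose k below =
    count-filter (λ X → rank M X ℕ.≟ k) Flat? (λ X → ∣ X ∣ ℕ.≟ k) (allSubsets n)
      (λ {X} _ → flat-of-rank⇔size k below X)

  -- At the girth k+2 some (k+1)-subset, a circuit minus a point, is not the
  -- first k+1 elements of any rank-(k+1) flat, while sending a flat to its first
  -- k+1 elements (one of its bases) is injective: so W_{k+1} < (n choose k+1).
  flatCount<choose : ∀ k {C} → IndepBelow (suc (suc k)) → IsCircuit indep C → ∣ C ∣ ≡ suc (suc k) →
                     flatCount (suc k) < choose n (suc k)
  flatCount<choose k {C} below circC ∣C∣≡ =
    injection-missing⇒length< (prefix (suc k)) rankFlats kSubsets
      (UniqueP.filter⁺ (λ X → rank M X ℕ.≟ suc k) flats-unique) injective
      (λ F∈ → size-k (∣prefix-of-flat∣ F∈))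
      (size-k (∣dropMin∣ (suc k) C ∣C∣≡)) dropMin-missed
    where
    rankFlats  = filter (λ X → rank M X ℕ.≟ suc k) (flats M)
    kSubsets   = filter (λ X → ∣ X ∣ ℕ.≟ suc k) (allSubsets n)

    size-k : ∀ {X} → ∣ X ∣ ≡ suc k → X ∈ kSubsets
    size-k {X} = ∈-filter⁺ (λ X → ∣ X ∣ ℕ.≟ suc k) (allSubsets-complete n X)

    flat-of-rank : ∀ {F} → F ∈ rankFlats → Flat F × rank M F ≡ suc k
    flat-of-rank F∈ with ∈-filter⁻ (λ X → rank M X ℕ.≟ suc k) {xs = flats M} F∈
    ... | F∈flats , rF≡ = flats-sound F∈flats , rF≡

    ∣prefix-of-flat∣ : ∀ {F} → F ∈ rankFlats → ∣ prefix (suc k) F ∣ ≡ suc k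
    ∣prefix-of-flat∣ {F} F∈ = ∣prefix∣ (suc k) F (subst (_≤ ∣ F ∣) (proj₂ (flat-of-rank F∈)) (rank≤size F))

    small-indep : ∀ {X} → ∣ X ∣ ≡ suc k → indep X ≡ true
    small-indep {X} ∣X∣≡ = below X (s≤s (ℕP.≤-reflexive ∣X∣≡))

    prefix-basis : ∀ {F} → F ∈ rankFlats →
                   indep (prefix (suc k) F) ≡ true × ∣ prefix (suc k) F ∣ ≡ rank M F
    prefix-basis F∈ = small-indep (∣prefix-of-flat∣ F∈) ,
                      trans (∣prefix-of-flat∣ F∈) (sym (proj₂ (flat-of-rank F∈)))

    injective : InjectiveOn (prefix (suc k)) rankFlats
    injective {F} {G} F∈ G∈ same-prefix =
      flats-sharing-basis (proj₁ (flat-of-rank F∈)) (proj₁ (flat-of-rank G∈))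
        (prefix-⊆ (suc k) F) (λ x∈ → prefix-⊆ (suc k) G (subst (_ ∈ₛ_) same-prefix x∈))
        (proj₁ (prefix-basis F∈)) (proj₂ (prefix-basis F∈))
        (trans (cong ∣_∣ same-prefix) (proj₂ (prefix-basis G∈)))

    dropMin-missed : dropMin C ∉ map (prefix (suc k)) rankFlats
    dropMin-missed D∈ with ∈-map⁻ (prefix (suc k)) D∈
    ... | F , F∈ , D≡prefix =
      prefix≢dropMin k C F
        (circuit-⊆-flat (proj₁ (flat-of-rank F∈)) circC
          (λ x∈ → prefix-⊆ (suc k) F (subst (_ ∈ₛ_) D≡prefix x∈))
          (subst (λ X → indep X ≡ true) (sym D≡prefix) (proj₁ (prefix-basis F∈)))
          (trans (cong ∣_∣ D≡prefix) (proj₂ (prefix-basis F∈))))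
        ∣C∣≡ (sym D≡prefix)

  next-threshold⇔count : ∀ k → IndepBelow (suc (suc k)) →
    IndepBelow (suc (suc (suc k))) ⇔ flatCount (suc k) ≡ choose n (suc k)
  next-threshold⇔count k below = mk⇔ (flatCount≡choose (suc k)) from
    where
    from : flatCount (suc k) ≡ choose n (suc k) → IndepBelow (suc (suc (suc k)))
    from count≡ with IndepBelow? (suc (suc (suc k)))
    ... | inj₁ below′ = below′
    ... | inj₂ (X , ∣X∣< , depX)
      with Equivalence.from (girth⇔threshold (suc (suc k)))
             (below , λ below′ → case trans (sym depX) (below′ X ∣X∣<) of λ ())
    ... | (C , circC , ∣C∣≡) , _ = ⊥-elim (ℕP.<⇒≢ (flatCount<choose k below circC ∣C∣≡) count≡)

-- Two families of coefficients of the Möbius polynomial: those in S-degree above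
-- the rank vanish, and the coefficient of S^k T^{r-k} counts the flats of rank k
-- (only the pairs x = y contribute, with μ(x,x) = 1).
module Coefficients {n : ℕ} (M : Matroid n) where
  open Sums
  open MatroidTheory M
  open FlatCounts M

  r : ℕ
  r = rank M ⊤

  mobius-diagonal : ∀ x → mobius M x x ≡ + 1
  mobius-diagonal x with x ≟ˢ x
  ... | yes _   = refl
  ... | no  x≢x = ⊥-elim (x≢x refl)

  term : ℕ → ℕ → Subset n → Subset n → ℤ
  term i j x y =
    if does (rank M x ℕ.≟ i) ∧ does ((r ∸ rank M y) ℕ.≟ j) ∧ does (x ⊆? y) then mobius M x y else + 0

  indicator : ℕ → Subset n → ℤ
  indicator k x = if does (rank M x ℕ.≟ k) then + 1 else + 0

  guard-on : ∀ {a b c : Bool} {u v : ℤ} → a ≡ true → b ≡ true → c ≡ true →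
             (if a ∧ b ∧ c then u else v) ≡ u
  guard-on refl refl refl = refl

  guard-off : ∀ {a b c : Bool} {u v : ℤ} → a ≡ false ⊎ b ≡ false ⊎ c ≡ false →
              (if a ∧ b ∧ c then u else v) ≡ v
  guard-off {false}                _                 = refl
  guard-off {true} {false}         _                 = refl
  guard-off {true} {true} {false}  _                 = refl
  guard-off {true} {true} {true}   (inj₁ ())
  guard-off {true} {true} {true}   (inj₂ (inj₁ ()))
  guard-off {true} {true} {true}   (inj₂ (inj₂ ()))

  term-on : ∀ {i j} x y → rank M x ≡ i → r ∸ rank M y ≡ j → x ⊆ₛ y → term i j x y ≡ mobius M x y
  term-on {i} {j} x y rx≡i r-ry≡j x⊆y =
    guard-on {does (rank M x ℕ.≟ i)} {does ((r ∸ rank M y) ℕ.≟ j)} {does (x ⊆? y)}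
      (dec-true (rank M x ℕ.≟ i) rx≡i) (dec-true ((r ∸ rank M y) ℕ.≟ j) r-ry≡j) (dec-true (x ⊆? y) x⊆y)

  term-off : ∀ {i j} x y → rank M x ≢ i ⊎ r ∸ rank M y ≢ j ⊎ ¬ x ⊆ₛ y → term i j x y ≡ + 0
  term-off {i} {j} x y failure =
    guard-off {does (rank M x ℕ.≟ i)} {does ((r ∸ rank M y) ℕ.≟ j)} {does (x ⊆? y)}
      (Data.Sum.map (dec-false (rank M x ℕ.≟ i))
        (Data.Sum.map (dec-false ((r ∸ rank M y) ℕ.≟ j)) (dec-false (x ⊆? y))) failure)

  coefficient-above-rank : ∀ i j → r < i → mobiusPolyCoeff M i j ≡ + 0
  coefficient-above-rank i j r<i =
    sum-zero _ (flats M) λ {x} _ → sum-zero (term i j x) (flats M) λ {y} _ →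
      term-off x y (inj₁ (λ rx≡i → ℕP.<⇒≱ r<i (subst (_≤ r) rx≡i (rank≤rank⊤ x))))

  coefficient-diagonal : ∀ k → k ≤ r → mobiusPolyCoeff M k (r ∸ k) ≡ + flatCount k
  coefficient-diagonal k k≤r =
    trans (sum-cong _ (indicator k) (flats M) row)
          (sum-indicator (λ x → rank M x ℕ.≟ k) (flats M))
    where
    row : ∀ {x} → x ∈ flats M → sumList (map (term k (r ∸ k) x) (flats M)) ≡ indicator k x
    row {x} x∈ with rank M x ℕ.≟ k
    ... | no  rx≢k = trans (sum-zero (term k (r ∸ k) x) (flats M) (λ {y} _ → term-off x y (inj₁ rx≢k)))
                           (sym (BP.if-cong (dec-false (rank M x ℕ.≟ k) rx≢k)))
    ... | yes rx≡k = trans (sum-single (term k (r ∸ k) x) (flats M) flats-unique x∈ off-diagonal on-diagonal)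
                           (sym (BP.if-cong (dec-true (rank M x ℕ.≟ k) rx≡k)))
      where
      -- a flat y ⊇ x of the same rank as x is x itself
      off-diagonal : ∀ {y} → y ∈ flats M → y ≢ x → term k (r ∸ k) x y ≡ + 0
      off-diagonal {y} y∈ y≢x = term-off x y (inj₂ not-above)
        where
        not-above : r ∸ rank M y ≢ r ∸ k ⊎ ¬ x ⊆ₛ y
        not-above with (r ∸ rank M y) ℕ.≟ (r ∸ k) | x ⊆? y
        ... | no  r-ry≢ | _        = inj₁ r-ry≢
        ... | yes _     | no  x⊈y  = inj₂ x⊈y
        ... | yes r-ry≡ | yes x⊆y = ⊥-elim (y≢x (sym (flat-⊆-same-rank (flats-sound x∈) x⊆y
                                     (trans rx≡k (ℕP.∸-cancelˡ-≡ k≤r (rank≤rank⊤ y) (sym r-ry≡))))))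

      on-diagonal : term k (r ∸ k) x x ≡ + 1
      on-diagonal = trans (term-on x x rx≡k (cong (r ∸_) rx≡k) id) (mobius-diagonal x)

module SamePolynomial where
  open Subsets using (choose; choose-one)
  open FlatCounts using (flatCount)

  SameCoefficients : ∀ {m n} → Matroid m → Matroid n → Set
  SameCoefficients M N = ∀ i j → mobiusPolyCoeff M i j ≡ mobiusPolyCoeff N i j

  -- The top coefficient of N, which counts its (nonempty set of) rank-r(N) flats,
  -- would vanish for M if r(M) < r(N).
  rank⊤-≤ : ∀ {m n} (M : Matroid m) (N : Matroid n) → SameCoefficients M N → rank N ⊤ ≤ rank M ⊤
  rank⊤-≤ M N same = ℕP.≮⇒≥ λ rM<rN → ℕP.<⇒≱ (FlatCounts.flatCount-rank⊤ N)
    (ℕP.≤-reflexive (ℤP.+-injective (begin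
      + flatCount N rN                 ≡⟨ Coefficients.coefficient-diagonal N rN ℕP.≤-refl ⟨
      mobiusPolyCoeff N rN (rN ∸ rN)   ≡⟨ same rN (rN ∸ rN) ⟨
      mobiusPolyCoeff M rN (rN ∸ rN)   ≡⟨ Coefficients.coefficient-above-rank M rN (rN ∸ rN) rM<rN ⟩
      + 0                              ∎)))
    where
    open ≡-Reasoning
    rN = rank N ⊤

  module _ {m n} (M : Matroid m) (N : Matroid n) (same : SameCoefficients M N) where

    same-rank⊤ : rank M ⊤ ≡ rank N ⊤
    same-rank⊤ = ℕP.≤-antisym (rank⊤-≤ N M (λ i j → sym (same i j))) (rank⊤-≤ M N same)

    same-flatCount : ∀ k → flatCount M k ≡ flatCount N k
    same-flatCount k with k ℕP.≤? rank M ⊤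
    ... | yes k≤rM = ℤP.+-injective (begin
      + flatCount M k                        ≡⟨ Coefficients.coefficient-diagonal M k k≤rM ⟨
      mobiusPolyCoeff M k (rank M ⊤ ∸ k)     ≡⟨ same k (rank M ⊤ ∸ k) ⟩
      mobiusPolyCoeff N k (rank M ⊤ ∸ k)     ≡⟨ cong (λ r → mobiusPolyCoeff N k (r ∸ k)) same-rank⊤ ⟩
      mobiusPolyCoeff N k (rank N ⊤ ∸ k)     ≡⟨ Coefficients.coefficient-diagonal N k (subst (k ≤_) same-rank⊤ k≤rM) ⟩
      + flatCount N k                        ∎)
      where open ≡-Reasoning
    ... | no  k≰rM = trans (FlatCounts.flatCount-above-rank M k (ℕP.≰⇒> k≰rM))
                       (sym (FlatCounts.flatCount-above-rank N k (subst (_< k) same-rank⊤ (ℕP.≰⇒> k≰rM))))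

    -- In a simple matroid the rank-1 flats are the points, so W₁ is the size
    -- of the ground set.
    same-groundSize : IsSimple (Matroid.indep M) → IsSimple (Matroid.indep N) → m ≡ n
    same-groundSize simpleM simpleN = begin
      m                ≡⟨ choose-one m ⟨
      choose m 1       ≡⟨ FlatCounts.flatCount≡choose M 1 (MatroidTheory.simple⇒IndepBelow3 M simpleM) ⟨
      flatCount M 1    ≡⟨ same-flatCount 1 ⟩
      flatCount N 1    ≡⟨ FlatCounts.flatCount≡choose N 1 (MatroidTheory.simple⇒IndepBelow3 N simpleN) ⟩
      choose n 1       ≡⟨ choose-one n ⟩
      n                ∎
      where open ≡-Reasoning

  -- For matroids on the same ground set, "all sets of size < j are independent"
  -- transfers from M to N: up to j = 3 by simplicity of N, and each further step
  -- by next-threshold⇔count, since the flat counts agree.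
  IndepBelow-transfer : ∀ {n} (M N : Matroid n) → IsSimple (Matroid.indep N) → SameCoefficients M N →
                        ∀ j → MatroidTheory.IndepBelow M j → MatroidTheory.IndepBelow N j
  IndepBelow-transfer M N simpleN same = transfer
    where
    open MatroidTheory using (IndepBelow; IndepBelow-mono; simple⇒IndepBelow3)
    belowN3 = simple⇒IndepBelow3 N simpleN

    transfer : ∀ j → IndepBelow M j → IndepBelow N j
    transfer zero                   _      = IndepBelow-mono N z≤n belowN3
    transfer (suc zero)             _      = IndepBelow-mono N (s≤s z≤n) belowN3
    transfer (suc (suc zero))       _      = IndepBelow-mono N (s≤s (s≤s z≤n)) belowN3
    transfer (suc (suc (suc k)))    belowM =
      Equivalence.from (FlatCounts.next-threshold⇔count N k (transfer (suc (suc k)) belowM′))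
        (trans (sym (same-flatCount M N same (suc k)))
               (Equivalence.to (FlatCounts.next-threshold⇔count M k belowM′) belowM))
      where belowM′ = IndepBelow-mono M (ℕP.n≤1+n _) belowM

  -- The girth is the threshold of IndepBelow, and both sides of the threshold
  -- transfer (the upper side by transferring back from N to M).
  girth-transfer : ∀ {n} (M N : Matroid n) → IsSimple (Matroid.indep M) → IsSimple (Matroid.indep N) →
                   SameCoefficients M N → ∀ d → IsGirth M d → IsGirth N d
  girth-transfer M N simpleM simpleN same d girthM
    with Equivalence.to (MatroidTheory.girth⇔threshold M d) girthM
  ... | belowM , not-belowM = Equivalence.from (MatroidTheory.girth⇔threshold N d)
          ( IndepBelow-transfer M N simpleN same d belowM
          , not-belowM ∘ IndepBelow-transfer N M simpleM (λ i j → sym (same i j)) (suc d))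

open SamePolynomial

mainTheorem3 : ∀ {m n} (M : Matroid m) (N : Matroid n) →
    SimpleWithSimpleDual M → SimpleWithSimpleDual N →
    (∀ i j → mobiusPolyCoeff M i j ≡ mobiusPolyCoeff N i j) →
    ∀ d → IsGirth M d ⇔ IsGirth N d
mainTheorem3 M N (simpleM , _) (simpleN , _) same d
  with same-groundSize M N same simpleM simpleN
... | refl = mk⇔ (girth-transfer M N simpleM simpleN same d)
                 (girth-transfer N M simpleN simpleM (λ i j → sym (same i j)) d)
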